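{- Let $\sigma$ be a prolongable morphism defined on a finite alphabet $\mathcal{A}$, let $\mathbf{a}$ be the associated fixed point and let $a$ be the first letter of $\mathbf{a}$. Then there exists a positive constant $c$ such that, for every positive integer $n$ and every letter $b$ occurring in $\mathbf{a}$, we have $|\sigma^n(a)|\ge c\,|\sigma^n(b)|$.
   Context: A morphism $\sigma$ on a finite set $\mathcal{A}$ is a monoid homomorphism of the free monoid $\mathcal{A}^*$ into itself. It is prolongable if there is a letter $a$ with $\sigma(a)=aW$, where $W$ is a word such that $\sigma^n(W)$ is non-empty for every $n\ge0$; in that case the words $\sigma^n(a)$ converge (in the product topology) to an infinite word $\mathbf{a}=\lim_{n\to\infty}\sigma^n(a)$, the associated fixed point of $\sigma$. $|U|$ denotes the length of a word $U$. -}

module Defs where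

open import Data.Nat using (ℕ; zero; suc; _≤_; _<_)
open import Data.Fin using (Fin)
open import Data.List using (List; []; _∷_; _++_; concatMap)
open import Data.Maybe using (Maybe; nothing; just)
open import Data.Product using (Σ; ∃; _×_)
open import Relation.Binary.PropositionalEquality using (_≡_; _≢_)

Morphism : ℕ → Set
Morphism k = Fin k → List (Fin k)

apply : ∀ {k} → Morphism k → List (Fin k) → List (Fin k)
apply σ w = concatMap σ w

iter : ∀ {k} → Morphism k → ℕ → List (Fin k) → List (Fin k)
iter σ zero    w = w
iter σ (suc n) w = apply σ (iter σ n w)

nth : ∀ {A : Set} → List A → ℕ → Maybe A
nth []       _       = nothing
nth (x ∷ xs) zero    = just x
nth (x ∷ xs) (suc i) = nth xs i

ProlongableOn : ∀ {k} → Morphism k → Fin k → Set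
ProlongableOn {k} σ a =
  Σ (List (Fin k)) λ W → (σ a ≡ a ∷ W) × (∀ n → iter σ n W ≢ [])

-- x : ℕ → 𝒜 is the limit of σⁿ(a) in the product topology:
-- for every m, eventually the first m letters of σⁿ(a) exist and agree with x.
IsLimitOfIterates : ∀ {k} → Morphism k → Fin k → (ℕ → Fin k) → Set
IsLimitOfIterates σ a x =
  ∀ m → ∃ λ N → ∀ n → N ≤ n → ∀ i → i < m → nth (iter σ n (a ∷ [])) i ≡ just (x i)

OccursIn : ∀ {k} → Fin k → (ℕ → Fin k) → Set
OccursIn b x = ∃ λ i → x i ≡ b

-- Since σ(a) begins with a, the sets of letters of σʲ(a) increase with j, so
-- they stall at some j ≤ |𝒜|; from then on they are closed under σ, and every
-- letter b of 𝐚 already occurs in σʲ(a). Then σⁿ(b) is a factor of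
-- σⁿ(σʲ(a)) = σʲ(σⁿ(a)), whose length is at most Mʲ |σⁿ(a)| where M bounds the
-- lengths of the images of letters, and c = 1 / (Mʲ + 1) works.

module Submission where

open import Defs
open import Data.Nat using (ℕ; suc)
open import Data.Fin using (Fin)
open import Data.List using (List; []; _∷_; length; _++_; [_]; allFin; map)
open import Data.Integer using (+_)
open import Data.Rational using (ℚ; 0ℚ; _≤_; _<_; _*_; _/_; toℚᵘ)
open import Data.Product using (Σ; _×_; _,_; ∃)

import Data.Nat as ℕ
import Data.Nat.Properties as ℕₚ
import Data.Integer as ℤ
import Data.Integer.Properties as ℤₚ
import Data.Rational.Unnormalised as ℚᵘ
import Data.Rational.Unnormalised.Properties as ℚᵘₚ
open import Data.Rational.Properties
  using (toℚᵘ-cancel-≤; toℚᵘ-homo-*; toℚᵘ-fromℚᵘ; normalize-pos; positive⁻¹)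
open import Data.Fin.Subset
  using (Subset; ⁅_⁆; _∪_; ∣_∣)
  renaming (⊥ to ∅; _∈_ to _∈ₛ_; _⊆_ to _⊆ₛ_)
open import Data.Fin.Subset.Properties
  using (_∈?_; _⊂?_; ∉⊥; x∈⁅x⁆; x∈⁅y⁆⇒x≡y; x∈p∪q⁺; x∈p∪q⁻; ∣p∣≤n; p⊂q⇒∣p∣<∣q∣)
open import Data.List.Properties using (length-++; length-++-≤ˡ; length-++-≤ʳ; concatMap-++)
open import Data.List.Membership.Propositional using (_∈_)
open import Data.List.Membership.Propositional.Properties
  using (∈-∃++; ∈-++⁺ˡ; ∈-map⁺; ∈-allFin)
open import Data.List.Relation.Binary.Subset.Propositional using (_⊆_)
open import Data.List.Relation.Binary.Subset.Propositional.Properties using (concatMap⁺)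
open import Data.List.Relation.Unary.Any using (here; there)
import Data.List.Relation.Unary.All as All
open import Data.List.Extrema.Nat using (max; xs≤max)
open import Data.Maybe using (just)
open import Data.Sum using (_⊎_; inj₁; inj₂; [_,_]′)
open import Data.Empty using (⊥-elim)
open import Function using (_∘_; id)
open import Relation.Nullary using (yes; no; contradiction)
open import Relation.Nullary.Decidable using (decidable-stable)
open import Relation.Binary.PropositionalEquality
  using (_≡_; refl; sym; cong; subst; module ≡-Reasoning)

1/suc-pos : ∀ d → 0ℚ < + 1 / suc d
1/suc-pos d = positive⁻¹ _ {{normalize-pos 1 (suc d)}}

-- `i / suc d` unfolds to `fromℚᵘ (mkℚᵘ i d)`, so the inequality can be checked
-- on unnormalised fractions.
1/suc-*-≤ : ∀ d {x y} → x ℕ.≤ y ℕ.* suc d → (+ 1 / suc d) * (+ x / 1) ≤ + y / 1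
1/suc-*-≤ d {x} {y} x≤yd = toℚᵘ-cancel-≤ (begin
  toℚᵘ ((+ 1 / suc d) * (+ x / 1))   ≃⟨ toℚᵘ-homo-* (+ 1 / suc d) (+ x / 1) ⟩
  toℚᵘ (+ 1 / suc d) ℚᵘ.* toℚᵘ (+ x / 1)
    ≃⟨ ℚᵘₚ.*-cong (toℚᵘ-fromℚᵘ (ℚᵘ.mkℚᵘ (+ 1) d)) (toℚᵘ-fromℚᵘ (ℚᵘ.mkℚᵘ (+ x) 0)) ⟩
  ℚᵘ.mkℚᵘ (+ 1) d ℚᵘ.* ℚᵘ.mkℚᵘ (+ x) 0   ≤⟨ ℚᵘ.*≤* cross-≤ ⟩
  ℚᵘ.mkℚᵘ (+ y) 0                        ≃⟨ toℚᵘ-fromℚᵘ (ℚᵘ.mkℚᵘ (+ y) 0) ⟨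
  toℚᵘ (+ y / 1)                      ∎)
  where
  open ℚᵘₚ.≤-Reasoning
  cross-≤ : (+ 1 ℤ.* + x) ℤ.* + 1 ℤ.≤ + y ℤ.* + (suc d ℕ.* 1)
  cross-≤ rewrite ℤₚ.*-identityʳ (+ 1 ℤ.* + x) | ℤₚ.*-identityˡ (+ x)
                | ℕₚ.*-identityʳ (suc d) | sym (ℤₚ.pos-* y (suc d)) = ℤ.+≤+ x≤yd

ascending-⊆-chain-stalls : ∀ {n} (S : ℕ → Subset n) → (∀ j → S j ⊆ₛ S (suc j)) →
                           ∃ λ j → S (suc j) ⊆ₛ S j
ascending-⊆-chain-stalls {n} S S⊆S′ =
  [ id , (λ n<∣S∣ → contradiction (∣p∣≤n (S (suc n))) (ℕₚ.<⇒≱ n<∣S∣)) ]′ (stalls-or-grows (suc n))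
  where
  stalls-or-grows : ∀ j → (∃ λ i → S (suc i) ⊆ₛ S i) ⊎ j ℕ.≤ ∣ S j ∣
  stalls-or-grows ℕ.zero = inj₂ ℕ.z≤n
  stalls-or-grows (suc j) with stalls-or-grows j | S j ⊂? S (suc j)
  ... | inj₁ stall  | _     = inj₁ stall
  ... | inj₂ j≤∣Sj∣ | yes ⊂ = inj₂ (ℕₚ.≤-<-trans j≤∣Sj∣ (p⊂q⇒∣p∣<∣q∣ ⊂))
  ... | inj₂ _      | no ⊄  = inj₁ (j , λ {x} x∈ →
    decidable-stable (x ∈? S j) (λ x∉ → ⊄ (S⊆S′ j , x , x∈ , x∉)))

letters : ∀ {n} → List (Fin n) → Subset n
letters []      = ∅
letters (x ∷ w) = ⁅ x ⁆ ∪ letters w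

∈-letters⁺ : ∀ {n} {x : Fin n} {w} → x ∈ w → x ∈ₛ letters w
∈-letters⁺ (here refl) = x∈p∪q⁺ (inj₁ (x∈⁅x⁆ _))
∈-letters⁺ (there x∈w) = x∈p∪q⁺ (inj₂ (∈-letters⁺ x∈w))

∈-letters⁻ : ∀ {n} {x : Fin n} w → x ∈ₛ letters w → x ∈ w
∈-letters⁻ []      x∈ = ⊥-elim (∉⊥ x∈)
∈-letters⁻ (y ∷ w) x∈ with x∈p∪q⁻ ⁅ y ⁆ (letters w) x∈
... | inj₁ x∈⁅y⁆ = here (x∈⁅y⁆⇒x≡y y x∈⁅y⁆)
... | inj₂ x∈w   = there (∈-letters⁻ w x∈w)

nth≡just⇒∈ : ∀ {A : Set} (xs : List A) i {x} → nth xs i ≡ just x → x ∈ xs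
nth≡just⇒∈ (y ∷ xs) ℕ.zero  refl = here refl
nth≡just⇒∈ (y ∷ xs) (suc i) eq   = there (nth≡just⇒∈ xs i eq)

module _ {k} (σ : Morphism k) where

  iter-++ : ∀ n u v → iter σ n (u ++ v) ≡ iter σ n u ++ iter σ n v
  iter-++ ℕ.zero  u v = refl
  iter-++ (suc n) u v = begin
    apply σ (iter σ n (u ++ v))                ≡⟨ cong (apply σ) (iter-++ n u v) ⟩
    apply σ (iter σ n u ++ iter σ n v)         ≡⟨ concatMap-++ σ (iter σ n u) (iter σ n v) ⟩
    apply σ (iter σ n u) ++ apply σ (iter σ n v) ∎
    where open ≡-Reasoning

  iter-+ : ∀ m n w → iter σ (m ℕ.+ n) w ≡ iter σ m (iter σ n w)
  iter-+ ℕ.zero  n w = refl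
  iter-+ (suc m) n w = cong (apply σ) (iter-+ m n w)

  iter-comm : ∀ m n w → iter σ m (iter σ n w) ≡ iter σ n (iter σ m w)
  iter-comm m n w = begin
    iter σ m (iter σ n w) ≡⟨ iter-+ m n w ⟨
    iter σ (m ℕ.+ n) w    ≡⟨ cong (λ t → iter σ t w) (ℕₚ.+-comm m n) ⟩
    iter σ (n ℕ.+ m) w    ≡⟨ iter-+ n m w ⟩
    iter σ n (iter σ m w) ∎
    where open ≡-Reasoning

  length-iter-∈ : ∀ n {b w} → b ∈ w → length (iter σ n [ b ]) ℕ.≤ length (iter σ n w)
  length-iter-∈ n {b} b∈w with ∈-∃++ b∈w
  ... | u , v , refl = begin
    length (iter σ n [ b ])                     ≤⟨ length-++-≤ˡ (iter σ n [ b ]) ⟩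
    length (iter σ n [ b ] ++ iter σ n v)       ≤⟨ length-++-≤ʳ _ {iter σ n u} ⟩
    length (iter σ n u ++ iter σ n [ b ] ++ iter σ n v)
      ≡⟨ cong (λ t → length (iter σ n u ++ t)) (iter-++ n [ b ] v) ⟨
    length (iter σ n u ++ iter σ n (b ∷ v))     ≡⟨ cong length (iter-++ n u (b ∷ v)) ⟨
    length (iter σ n (u ++ b ∷ v))              ∎
    where open ℕₚ.≤-Reasoning

  maxImageLength : ℕ
  maxImageLength = max 0 (map (length ∘ σ) (allFin k))

  length-image≤max : ∀ x → length (σ x) ℕ.≤ maxImageLength
  length-image≤max x = All.lookup (xs≤max 0 _) (∈-map⁺ (length ∘ σ) (∈-allFin x))

  length-apply-≤ : ∀ w → length (apply σ w) ℕ.≤ length w ℕ.* maxImageLength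
  length-apply-≤ []      = ℕ.z≤n
  length-apply-≤ (x ∷ w) = begin
    length (σ x ++ apply σ w)               ≡⟨ length-++ (σ x) ⟩
    length (σ x) ℕ.+ length (apply σ w)
      ≤⟨ ℕₚ.+-mono-≤ (length-image≤max x) (length-apply-≤ w) ⟩
    maxImageLength ℕ.+ length w ℕ.* maxImageLength ∎
    where open ℕₚ.≤-Reasoning

  length-iter-≤ : ∀ j w → length (iter σ j w) ℕ.≤ length w ℕ.* maxImageLength ℕ.^ j
  length-iter-≤ ℕ.zero  w = ℕₚ.≤-reflexive (sym (ℕₚ.*-identityʳ (length w)))
  length-iter-≤ (suc j) w = begin
    length (apply σ (iter σ j w))  ≤⟨ length-apply-≤ (iter σ j w) ⟩
    length (iter σ j w) ℕ.* M      ≤⟨ ℕₚ.*-monoˡ-≤ M (length-iter-≤ j w) ⟩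
    length w ℕ.* M ℕ.^ j ℕ.* M     ≡⟨ ℕₚ.*-assoc (length w) (M ℕ.^ j) M ⟩
    length w ℕ.* (M ℕ.^ j ℕ.* M)   ≡⟨ cong (length w ℕ.*_) (ℕₚ.*-comm (M ℕ.^ j) M) ⟩
    length w ℕ.* M ℕ.^ suc j       ∎
    where
    open ℕₚ.≤-Reasoning
    M : ℕ
    M = maxImageLength

  apply-closed⇒iter-closed : ∀ {w} → apply σ w ⊆ w → ∀ d → iter σ d w ⊆ w
  apply-closed⇒iter-closed closed ℕ.zero  = id
  apply-closed⇒iter-closed closed (suc d) =
    closed ∘ concatMap⁺ σ (apply-closed⇒iter-closed closed d)

  occurs⇒∈-closed-iter : ∀ {a 𝐚 b} j → apply σ (iter σ j [ a ]) ⊆ iter σ j [ a ] →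
                         IsLimitOfIterates σ a 𝐚 → OccursIn b 𝐚 → b ∈ iter σ j [ a ]
  occurs⇒∈-closed-iter {a} {𝐚} j closed lim (i , refl) with lim (suc i)
  ... | N , agrees = apply-closed⇒iter-closed closed N (subst (𝐚 i ∈_) (iter-+ N j [ a ]) 𝐚ᵢ∈)
    where
    𝐚ᵢ∈ : 𝐚 i ∈ iter σ (N ℕ.+ j) [ a ]
    𝐚ᵢ∈ = nth≡just⇒∈ _ i (agrees (N ℕ.+ j) (ℕₚ.m≤m+n N j) i (ℕₚ.n<1+n i))

  module _ {a W} (σa≡aW : σ a ≡ a ∷ W) where

    iter-⊆-iter-suc : ∀ j → iter σ j [ a ] ⊆ iter σ (suc j) [ a ]
    iter-⊆-iter-suc j {x} x∈ = subst (x ∈_) (sym iter-suc≡) (∈-++⁺ˡ x∈)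
      where
      iter-suc≡ : iter σ (suc j) [ a ] ≡ iter σ j [ a ] ++ iter σ j (W ++ [])
      iter-suc≡ = begin
        iter σ 1 (iter σ j [ a ])             ≡⟨ iter-comm 1 j [ a ] ⟩
        iter σ j (σ a ++ [])                  ≡⟨ cong (λ u → iter σ j (u ++ [])) σa≡aW ⟩
        iter σ j ([ a ] ++ W ++ [])           ≡⟨ iter-++ j [ a ] (W ++ []) ⟩
        iter σ j [ a ] ++ iter σ j (W ++ [])  ∎
        where open ≡-Reasoning

    iterate-eventually-closed : ∃ λ j → apply σ (iter σ j [ a ]) ⊆ iter σ j [ a ]
    iterate-eventually-closed
      with j , stall ← ascending-⊆-chain-stalls (λ j → letters (iter σ j [ a ]))
                         (λ j → ∈-letters⁺ ∘ iter-⊆-iter-suc j ∘ ∈-letters⁻ _)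
      = j , ∈-letters⁻ _ ∘ stall ∘ ∈-letters⁺

  length-iter-letter-≤ : ∀ {a b} j n → b ∈ iter σ j [ a ] →
                         length (iter σ n [ b ]) ℕ.≤ length (iter σ n [ a ]) ℕ.* maxImageLength ℕ.^ j
  length-iter-letter-≤ {a} {b} j n b∈ = begin
    length (iter σ n [ b ])                 ≤⟨ length-iter-∈ n b∈ ⟩
    length (iter σ n (iter σ j [ a ]))      ≡⟨ cong length (iter-comm n j [ a ]) ⟩
    length (iter σ j (iter σ n [ a ]))      ≤⟨ length-iter-≤ j (iter σ n [ a ]) ⟩
    length (iter σ n [ a ]) ℕ.* maxImageLength ℕ.^ j ∎
    where open ℕₚ.≤-Reasoning

lemma2 : ∀ {k} (σ : Morphism k) (a : Fin k) (𝐚 : ℕ → Fin k)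
           → ProlongableOn σ a
           → IsLimitOfIterates σ a 𝐚
           → Σ ℚ λ c → (0ℚ < c) ×
               (∀ (n : ℕ) (b : Fin k) → OccursIn b 𝐚 →
                 c * ((+ length (iter σ (suc n) (b ∷ []))) / 1)
                   ≤ (+ length (iter σ (suc n) (a ∷ []))) / 1)
lemma2 σ a 𝐚 (W , σa≡aW , _) lim
  with j , closed ← iterate-eventually-closed σ σa≡aW
  = + 1 / suc B , 1/suc-pos B , λ n b occurs →
      1/suc-*-≤ B {y = length (iter σ (suc n) [ a ])} (length-bound (suc n) occurs)
  where
  B : ℕ
  B = maxImageLength σ ℕ.^ j
  length-bound : ∀ n {b} → OccursIn b 𝐚 →
                 length (iter σ n [ b ]) ℕ.≤ length (iter σ n [ a ]) ℕ.* suc B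
  length-bound n occurs = ℕₚ.≤-trans
    (length-iter-letter-≤ σ j n (occurs⇒∈-closed-iter σ j closed lim occurs))
    (ℕₚ.*-monoʳ-≤ (length (iter σ n [ a ])) (ℕₚ.n≤1+n B))
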